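{- Let $k\geq 6$ be an integer. For every integer $t$ with $(k-1)(k-2)+1\leq t\leq k(k-1)$ we have $rx_3(K_{2,t})=k$.
   Context: All graphs are simple, finite and undirected. In an edge-colored graph $G$ (adjacent edges may share colors), a tree is a rainbow tree if no two of its edges have the same color; for $S\subseteq V(G)$, an $S$-tree is a tree in $G$ containing all vertices of $S$. A $3$-rainbow coloring of $G$ is an edge coloring such that for every set $S$ of $3$ vertices there is a rainbow $S$-tree. The $3$-rainbow index $rx_3(G)$ is the minimum number of colors in a $3$-rainbow coloring of $G$. $K_{2,t}$ is the complete bipartite graph with parts of sizes $2$ and $t$. -}

module Defs where

open import Data.Nat using (ℕ; _≤_; _<_)
open import Data.Fin using (Fin; toℕ)
open import Data.List using (List; []; _∷_; map)
open import Data.List.Membership.Propositional using (_∈_; _∉_)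
open import Data.List.Relation.Unary.Unique.Propositional using (Unique)
open import Data.Product using (_×_; _,_; Σ; ∃)
open import Data.Sum using (_⊎_)
open import Relation.Binary.PropositionalEquality using (_≡_; _≢_)
open import Relation.Nullary using (¬_)

record Graph : Set₁ where
  field
    n     : ℕ
    Adj   : Fin n → Fin n → Set
    sym   : ∀ {u v} → Adj u v → Adj v u
    irrefl : ∀ {u} → ¬ Adj u u
open Graph public

-- Complete bipartite graph K_{2,t}: vertices 0,1 form one part,
-- vertices 2,…,t+1 form the other part.
K2 : ℕ → Graph
K2 t = record
  { n = 2 Data.Nat.+ t
  ; Adj = λ u v → (toℕ u < 2 × 2 ≤ toℕ v) ⊎ (2 ≤ toℕ u × toℕ v < 2)
  ; sym = λ { (Data.Sum.inj₁ (a , b)) → Data.Sum.inj₂ (b , a)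
            ; (Data.Sum.inj₂ (a , b)) → Data.Sum.inj₁ (b , a) }
  ; irrefl = λ { (Data.Sum.inj₁ (a , b)) → Data.Nat.Properties.<⇒≱ a b
               ; (Data.Sum.inj₂ (a , b)) → Data.Nat.Properties.<⇒≱ b a } }
  where import Data.Nat.Properties

-- An edge coloring of G with (at most) k colors: a colour for every
-- unordered pair, i.e. a symmetric function (values on non-edges irrelevant).
record EdgeColoring (G : Graph) (k : ℕ) : Set where
  field
    col    : Fin (n G) → Fin (n G) → Fin k
    col-sym : ∀ u v → col u v ≡ col v u
open EdgeColoring public

data Tree (G : Graph) : List (Fin (n G)) → List (Fin (n G) × Fin (n G)) → Set where
  single : (v : Fin (n G)) → Tree G (v ∷ []) []
  grow   : ∀ {vs es} {u w : Fin (n G)} → Tree G vs es → u ∈ vs → w ∉ vs →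
           Adj G u w → Tree G (w ∷ vs) ((u , w) ∷ es)

edgeColor : ∀ {G k} → EdgeColoring G k → Fin (n G) × Fin (n G) → Fin k
edgeColor c (u , w) = col c u w

RainbowSTree3 : ∀ {G k} → EdgeColoring G k → (x y z : Fin (n G)) → Set
RainbowSTree3 {G} c x y z =
  Σ (List (Fin (n G))) λ vs → Σ (List (Fin (n G) × Fin (n G))) λ es →
    Tree G vs es × Unique (map (edgeColor c) es) × x ∈ vs × y ∈ vs × z ∈ vs

Is3Rainbow : ∀ {G k} → EdgeColoring G k → Set
Is3Rainbow {G} c = ∀ (x y z : Fin (n G)) → x ≢ y → x ≢ z → y ≢ z →
  RainbowSTree3 c x y z

Rx3≡ : Graph → ℕ → Set
Rx3≡ G k = (Σ (EdgeColoring G k) Is3Rainbow) ×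
           (∀ j → j < k → ¬ Σ (EdgeColoring G j) Is3Rainbow)

module Submission where

-- Call the two vertices of the small side hubs and the other t vertices
-- leaves; a colouring gives leaf i the pair (α i , β i) of colours of its
-- two edges.
--
-- A rainbow tree through three leaves has an edge at each of
-- them, with distinct colours, so any three leaves have distinct
-- representatives of their pairs (RainbowLeafPairs).  Such a family of
-- t ≥ 3 pairs over J colours can be oriented injectively into ordered pairs
-- of distinct colours (Orientation), so J < k colours would give
-- t ≤ J(J-1) ≤ (k-1)(k-2) < t.
--
-- Label the leaves injectively by ordered pairs of distinct
-- colours so that any three colours are avoided by both labels of some
-- leaf; the induced colouring is 3-rainbow (LabelledColouring), and such a
-- labelling with k colours exists once 3(k-1)+4 < t ≤ k(k-1) (GridLabelling),
-- which the hypotheses guarantee for k ≥ 6.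

open import Defs
open import Data.Nat using (ℕ; zero; suc; _+_; _*_; _∸_; _≤_; _<_; z≤n; s≤s)
import Data.Nat.Properties as ℕ
open import Data.Fin using (Fin; toℕ; punchIn; punchOut; combine; remQuot; inject≤; fromℕ<)
  renaming (zero to fz; suc to fs; _<_ to _<ᶠ_)
open import Data.Fin.Properties
  using (_≟_; suc-injective; any?; _<?_; <-cmp; injective⇒≤; punchInᵢ≢i; punchIn-injective;
         punchIn-punchOut; punchOut-injective; combine-injective; combine-remQuot; remQuot-combine;
         inject≤-injective; toℕ-inject≤; toℕ-fromℕ<; toℕ-injective; toℕ-combine; toℕ<n)
open import Data.List using (List; []; _∷_; map; length; lookup)
open import Data.List.Membership.Propositional using (_∈_; _∉_)
open import Data.List.Membership.Propositional.Properties using (∈-map⁺; ∈-++⁺ˡ)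
import Data.List.Membership.DecPropositional as DecMembership
open import Data.List.Relation.Unary.Any using (here; there; index)
open import Data.List.Relation.Unary.Any.Properties using (lookup-index)
open import Data.List.Relation.Unary.All as All using (All; []; _∷_)
open import Data.List.Relation.Unary.All.Properties using (All¬⇒¬Any)
open import Data.List.Relation.Unary.AllPairs using ([]; _∷_)
open import Data.List.Relation.Unary.Unique.Propositional using (Unique)
open import Data.Product using (_×_; _,_; Σ; ∃; proj₁; proj₂; uncurry)
open import Data.Product.Properties using (×-≡,≡→≡)
open import Data.Sum using (_⊎_; inj₁; inj₂)
open import Data.Empty using (⊥; ⊥-elim)
open import Relation.Binary.PropositionalEquality
  using (_≡_; _≢_; refl; trans; cong; subst; ≢-sym) renaming (sym to ≡-sym)
open import Relation.Binary.Definitions using (tri<; tri≈; tri>)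
open import Relation.Nullary using (¬_; yes; no; Dec)
open import Relation.Nullary.Decidable using (_×-dec_)

tree-edge-adj : ∀ {G vs es} → Tree G vs es → ∀ {e} → e ∈ es → Adj G (proj₁ e) (proj₂ e)
tree-edge-adj (single _) ()
tree-edge-adj (grow _ _ _ a) (here refl) = a
tree-edge-adj (grow T _ _ a) (there e∈es) = tree-edge-adj T e∈es

tree-incident : ∀ {G vs es} → Tree G vs es → ∀ {u v} → u ∈ vs → v ∈ vs → u ≢ v →
                ∃ λ e → e ∈ es × (proj₁ e ≡ u ⊎ proj₂ e ≡ u)
tree-incident (single _) (here refl) (here refl) u≢v = ⊥-elim (u≢v refl)
tree-incident (grow {u = p} {w} _ _ _ _) (here refl) _ _ = (p , w) , here refl , inj₂ refl
tree-incident (grow {u = p} {w} T p∈ _ _) {u} (there u∈) (here refl) _ with u ≟ p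
... | yes refl = (p , w) , here refl , inj₁ refl
... | no u≢p with tree-incident T u∈ p∈ u≢p
...   | e , e∈ , inc = e , there e∈ , inc
tree-incident (grow T _ _ _) (there u∈) (there v∈) u≢v with tree-incident T u∈ v∈ u≢v
... | e , e∈ , inc = e , there e∈ , inc

unique-map-injective : ∀ {A B : Set} (f : A → B) {xs : List A} → Unique (map f xs) →
                       ∀ {x y} → x ∈ xs → y ∈ xs → f x ≡ f y → x ≡ y
unique-map-injective f (_ ∷ _) (here refl) (here refl) _ = refl
unique-map-injective f (fx∉ ∷ _) (here refl) (there y∈) eq = ⊥-elim (All.lookup fx∉ (∈-map⁺ f y∈) eq)
unique-map-injective f (fy∉ ∷ _) (there x∈) (here refl) eq = ⊥-elim (All.lookup fy∉ (∈-map⁺ f x∈) (≡-sym eq))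
unique-map-injective f (_ ∷ u) (there x∈) (there y∈) eq = unique-map-injective f u x∈ y∈ eq

fresh : ∀ {K n} (L : List (Fin K)) → length L < n → n ≤ K → ∃ λ x → toℕ x < n × x ∉ L
fresh {K} {n} L short n≤K with any? (λ i → DecMembership._∉?_ _≟_ (inject≤ i n≤K) L)
... | yes (i , i∉L) = inject≤ i n≤K , subst (_< n) (≡-sym (toℕ-inject≤ i n≤K)) (toℕ<n i) , i∉L
... | no none = ⊥-elim (ℕ.<⇒≱ short (injective⇒≤ position-injective))
  where
    member : ∀ i → inject≤ i n≤K ∈ L
    member i with DecMembership._∈?_ _≟_ (inject≤ i n≤K) L
    ... | yes i∈L = i∈L
    ... | no i∉L = ⊥-elim (none (i , i∉L))
    position-injective : ∀ {i j} → index (member i) ≡ index (member j) → i ≡ j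
    position-injective {i} {j} eq = inject≤-injective n≤K n≤K i j
      (trans (lookup-index (member i)) (trans (cong (lookup L) eq) (≡-sym (lookup-index (member j)))))

off-diagonal-bound : ∀ {J t} (g : Fin t → Fin J × Fin J) → (∀ v → proj₁ (g v) ≢ proj₂ (g v)) →
                     (∀ u v → g u ≡ g v → u ≡ v) → t ≤ J * (J ∸ 1)
off-diagonal-bound {zero} {zero} _ _ _ = z≤n
off-diagonal-bound {zero} {suc t} g _ _ with g fz
... | () , _
off-diagonal-bound {suc J} {t} g off inj = injective⇒≤ code-injective
  where
    code : Fin t → Fin (suc J * J)
    code v = combine (proj₁ (g v)) (punchOut (off v))
    code-injective : ∀ {u v} → code u ≡ code v → u ≡ v
    code-injective {u} {v} eq with combine-injective (proj₁ (g u)) _ (proj₁ (g v)) _ eq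
    ... | first≡ , rest≡ =
      inj u v (×-≡,≡→≡ (first≡ , punchOut-injective′ (off u) (off v) first≡ rest≡))
      where
        punchOut-injective′ : ∀ {n} {i i′ j j′ : Fin (suc n)} (i≢j : i ≢ j) (i′≢j′ : i′ ≢ j′) →
                              i ≡ i′ → punchOut i≢j ≡ punchOut i′≢j′ → j ≡ j′
        punchOut-injective′ i≢j i′≢j′ refl = punchOut-injective i≢j i′≢j′

hubA hubB : ∀ {t} → Fin (2 + t)
hubA = fz
hubB = fs fz

leaf : ∀ {t} → Fin t → Fin (2 + t)
leaf i = fs (fs i)

leaf-injective : ∀ {t} {i j : Fin t} → leaf i ≡ leaf j → i ≡ j
leaf-injective eq = suc-injective (suc-injective eq)

leaf≢ : ∀ {t} {u v : Fin t} → u ≢ v → leaf u ≢ leaf v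
leaf≢ u≢v eq = u≢v (leaf-injective eq)

-- Distinct representatives for triples of colour pairs.

OneOf : ∀ {A : Set} → A → A → A → Set
OneOf c x y = c ≡ x ⊎ c ≡ y

DistinctReps : ∀ {J t} → (Fin t → Fin J) → (Fin t → Fin J) → Set
DistinctReps {J} {t} α β = ∀ (u v w : Fin t) → u ≢ v → u ≢ w → v ≢ w →
  Σ (Fin J) λ cu → Σ (Fin J) λ cv → Σ (Fin J) λ cw →
    OneOf cu (α u) (β u) × OneOf cv (α v) (β v) × OneOf cw (α w) (β w) ×
    cu ≢ cv × cu ≢ cw × cv ≢ cw

-- The colour pairs at the leaves of a 3-rainbow colouring of K_{2,t}
-- have distinct representatives: the rainbow tree through three leaves
-- has an edge at each of them.
module RainbowLeafPairs {t j : ℕ} (c : EdgeColoring (K2 t) j) (rainbow : Is3Rainbow c) where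

  α β : Fin t → Fin j
  α i = col c hubA (leaf i)
  β i = col c hubB (leaf i)

  LeafEdge : Fin t → Fin (2 + t) × Fin (2 + t) → Set
  LeafEdge i e = (proj₁ e ≡ leaf i × toℕ (proj₂ e) < 2) ⊎ (proj₂ e ≡ leaf i × toℕ (proj₁ e) < 2)

  leafEdge-unique : ∀ {i i′ e} → LeafEdge i e → LeafEdge i′ e → i ≡ i′
  leafEdge-unique (inj₁ (refl , _)) (inj₁ (eq , _)) = leaf-injective eq
  leafEdge-unique (inj₁ (refl , _)) (inj₂ (refl , s≤s (s≤s ())))
  leafEdge-unique (inj₂ (refl , s≤s (s≤s ()))) (inj₁ (refl , _))
  leafEdge-unique (inj₂ (refl , _)) (inj₂ (eq , _)) = leaf-injective eq

  edge-at-leaf : ∀ i (e : Fin (2 + t) × Fin (2 + t)) → Adj (K2 t) (proj₁ e) (proj₂ e) →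
                 (proj₁ e ≡ leaf i ⊎ proj₂ e ≡ leaf i) → LeafEdge i e × OneOf (edgeColor c e) (α i) (β i)
  edge-at-leaf i (.(leaf i) , _) (inj₁ (s≤s (s≤s ()) , _)) (inj₁ refl)
  edge-at-leaf i (.(leaf i) , fz) (inj₂ (_ , lt)) (inj₁ refl) = inj₁ (refl , lt) , inj₁ (col-sym c (leaf i) fz)
  edge-at-leaf i (.(leaf i) , fs fz) (inj₂ (_ , lt)) (inj₁ refl) = inj₁ (refl , lt) , inj₂ (col-sym c (leaf i) (fs fz))
  edge-at-leaf i (.(leaf i) , fs (fs _)) (inj₂ (_ , s≤s (s≤s ()))) (inj₁ refl)
  edge-at-leaf i (fz , .(leaf i)) (inj₁ (lt , _)) (inj₂ refl) = inj₂ (refl , lt) , inj₁ refl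
  edge-at-leaf i (fs fz , .(leaf i)) (inj₁ (lt , _)) (inj₂ refl) = inj₂ (refl , lt) , inj₂ refl
  edge-at-leaf i (fs (fs _) , .(leaf i)) (inj₁ (s≤s (s≤s ()) , _)) (inj₂ refl)
  edge-at-leaf i (_ , .(leaf i)) (inj₂ (_ , s≤s (s≤s ()))) (inj₂ refl)

  distinct-reps : DistinctReps α β
  distinct-reps u v w u≢v u≢w v≢w
    with rainbow (leaf u) (leaf v) (leaf w) (leaf≢ u≢v) (leaf≢ u≢w) (leaf≢ v≢w)
  ... | vs , es , T , rainbow-es , u∈ , v∈ , w∈
    with tree-incident T u∈ v∈ (leaf≢ u≢v) | tree-incident T v∈ u∈ (leaf≢ (≢-sym u≢v))
       | tree-incident T w∈ u∈ (leaf≢ (≢-sym u≢w))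
  ... | eu , eu∈ , at-u | ev , ev∈ , at-v | ew , ew∈ , at-w
    with edge-at-leaf u eu (tree-edge-adj T eu∈) at-u | edge-at-leaf v ev (tree-edge-adj T ev∈) at-v
       | edge-at-leaf w ew (tree-edge-adj T ew∈) at-w
  ... | Lu , cu | Lv , cv | Lw , cw =
    edgeColor c eu , edgeColor c ev , edgeColor c ew , cu , cv , cw ,
    different eu∈ ev∈ Lu Lv u≢v , different eu∈ ew∈ Lu Lw u≢w , different ev∈ ew∈ Lv Lw v≢w
    where
      -- Edges at different leaves are different, hence differently coloured.
      different : ∀ {e e′ i i′} → e ∈ es → e′ ∈ es → LeafEdge i e → LeafEdge i′ e′ → i ≢ i′ →
                  edgeColor c e ≢ edgeColor c e′
      different e∈ e′∈ Le Le′ i≢i′ same-colour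
        with unique-map-injective (edgeColor c) rainbow-es e∈ e′∈ same-colour
      ... | refl = i≢i′ (leafEdge-unique Le Le′)

-- Given t ≥ 3 pairs over at least two colours with DistinctReps, we choose
-- for every member v an ordered pair orient v of distinct colours, both
-- colours of v among its entries, such that orient is injective:
--   * an off-diagonal pair keeps its order, unless an earlier member carries
--     the same ordered pair, in which case it is reversed;
--   * a diagonal pair (x , x) becomes (x , other x), unless some member
--     carries exactly that ordered pair, in which case it becomes (other x , x).
module Orientation {J t : ℕ} (α β : Fin t → Fin (2 + J)) (reps : DistinctReps α β) (3≤t : 3 ≤ t) where

  other : Fin (2 + J) → Fin (2 + J)
  other x = punchIn x fz

  other≢ : ∀ x → other x ≢ x
  other≢ x = punchInᵢ≢i x fz

  SamePair : Fin t → Fin t → Set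
  SamePair u v = α u ≡ α v × β u ≡ β v

  Repeated : Fin t → Set
  Repeated v = ∃ λ u → u <ᶠ v × SamePair u v

  Taken : Fin (2 + J) → Set
  Taken x = ∃ λ u → α u ≡ x × β u ≡ other x

  repeated? : ∀ v → Dec (Repeated v)
  repeated? v = any? (λ u → (u <? v) ×-dec ((α u ≟ α v) ×-dec (β u ≟ β v)))

  taken? : ∀ x → Dec (Taken x)
  taken? x = any? (λ u → (α u ≟ x) ×-dec (β u ≟ other x))

  data Oriented (v : Fin t) (pq : Fin (2 + J) × Fin (2 + J)) : Set where
    kept     : α v ≢ β v → ¬ Repeated v → pq ≡ (α v , β v) → Oriented v pq
    reversed : α v ≢ β v → Repeated v → pq ≡ (β v , α v) → Oriented v pq
    loopFree : α v ≡ β v → ¬ Taken (α v) → pq ≡ (α v , other (α v)) → Oriented v pq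
    loopTaken : α v ≡ β v → Taken (α v) → pq ≡ (other (α v) , α v) → Oriented v pq

  orientation : ∀ v → Σ (Fin (2 + J) × Fin (2 + J)) (Oriented v)
  orientation v with α v ≟ β v | repeated? v | taken? (α v)
  ... | no off | no new | _ = _ , kept off new refl
  ... | no off | yes rep | _ = _ , reversed off rep refl
  ... | yes loop | _ | no free = _ , loopFree loop free refl
  ... | yes loop | _ | yes tkn = _ , loopTaken loop tkn refl

  orient : Fin t → Fin (2 + J) × Fin (2 + J)
  orient v = proj₁ (orientation v)

  oriented-off-diagonal : ∀ {v pq} → Oriented v pq → proj₁ pq ≢ proj₂ pq
  oriented-off-diagonal (kept off _ refl) = off
  oriented-off-diagonal (reversed off _ refl) = ≢-sym off
  oriented-off-diagonal {v} (loopFree _ _ refl) = ≢-sym (other≢ (α v))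
  oriented-off-diagonal {v} (loopTaken _ _ refl) = other≢ (α v)

  Fits : Fin t → Fin (2 + J) × Fin (2 + J) → Set
  Fits v (p , q) = OneOf (α v) p q × OneOf (β v) p q

  oriented-fits : ∀ {v pq} → Oriented v pq → Fits v pq
  oriented-fits (kept _ _ refl) = inj₁ refl , inj₂ refl
  oriented-fits (reversed _ _ refl) = inj₂ refl , inj₁ refl
  oriented-fits (loopFree loop _ refl) = inj₁ refl , inj₁ (≡-sym loop)
  oriented-fits (loopTaken loop _ refl) = inj₂ refl , inj₂ (≡-sym loop)

  fits-same : ∀ {u v pq} → SamePair u v → Fits v pq → Fits u pq
  fits-same (same-α , same-β) fits rewrite same-α | same-β = fits

  -- No three members fit the same pair: their representatives would be
  -- three distinct colours out of two.
  no-three-fit : ∀ {u v w pq} → u ≢ v → u ≢ w → v ≢ w → Fits u pq → Fits v pq → Fits w pq → ⊥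
  no-three-fit {u} {v} {w} u≢v u≢w v≢w (au , bu) (av , bv) (aw , bw) with reps u v w u≢v u≢w v≢w
  ... | _ , _ , _ , cu , cv , cw , cu≢cv , cu≢cw , cv≢cw =
    pigeon (in-pair cu au bu) (in-pair cv av bv) (in-pair cw aw bw) cu≢cv cu≢cw cv≢cw
    where
      in-pair : ∀ {c x y p q : Fin (2 + J)} → OneOf c x y → OneOf x p q → OneOf y p q → OneOf c p q
      in-pair (inj₁ refl) x∈ _ = x∈
      in-pair (inj₂ refl) _ y∈ = y∈
      pigeon : ∀ {a b c p q : Fin (2 + J)} → OneOf a p q → OneOf b p q → OneOf c p q →
               a ≢ b → a ≢ c → b ≢ c → ⊥
      pigeon (inj₁ refl) (inj₁ refl) _ a≢b _ _ = a≢b refl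
      pigeon (inj₂ refl) (inj₂ refl) _ a≢b _ _ = a≢b refl
      pigeon (inj₁ refl) _ (inj₁ refl) _ a≢c _ = a≢c refl
      pigeon (inj₂ refl) _ (inj₂ refl) _ a≢c _ = a≢c refl
      pigeon _ (inj₁ refl) (inj₁ refl) _ _ b≢c = b≢c refl
      pigeon _ (inj₂ refl) (inj₂ refl) _ _ b≢c = b≢c refl

  -- No two members carry the same diagonal pair: together with any third
  -- member they would need two distinct representatives equal to x.
  no-two-loops : ∀ {u v} → u ≢ v → α u ≡ β u → α v ≡ β v → α u ≡ α v → ⊥
  no-two-loops {u} {v} u≢v loop-u loop-v same
    with fresh (u ∷ v ∷ []) (s≤s (s≤s (s≤s z≤n))) 3≤t
  ... | w , _ , w∉ with reps u v w u≢v (λ eq → w∉ (here (≡-sym eq))) (λ eq → w∉ (there (here (≡-sym eq))))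
  ... | _ , _ , _ , cu , cv , _ , cu≢cv , _ =
    cu≢cv (trans (on-loop cu loop-u) (trans same (≡-sym (on-loop cv loop-v))))
    where
      on-loop : ∀ {c x y : Fin (2 + J)} → OneOf c x y → x ≡ y → c ≡ x
      on-loop (inj₁ refl) _ = refl
      on-loop (inj₂ refl) x≡y = ≡-sym x≡y

  <⇒≢ : ∀ {a b : Fin t} → a <ᶠ b → a ≢ b
  <⇒≢ a<b refl = ℕ.<-irrefl refl a<b

  -- Two members with the same kept orientation carry the same ordered pair,
  -- so the later one would have been reversed.
  kept-collision : ∀ {u v} → u ≢ v → ¬ Repeated u → ¬ Repeated v → (α u , β u) ≡ (α v , β v) → ⊥
  kept-collision {u} {v} u≢v new-u new-v eq with <-cmp u v
  ... | tri< u<v _ _ = new-v (u , u<v , cong proj₁ eq , cong proj₂ eq)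
  ... | tri≈ _ u≡v _ = u≢v u≡v
  ... | tri> _ _ v<u = new-u (v , v<u , ≡-sym (cong proj₁ eq) , ≡-sym (cong proj₂ eq))

  -- A reversed member u shares its orientation with no other member v: the
  -- earlier member w carrying u's pair would be a third member fitting it,
  -- and if w = v then v itself is reversed and has a yet earlier copy.
  reversed-collision : ∀ {u v pq} → u ≢ v → α u ≢ β u → Repeated u → pq ≡ (β u , α u) →
                       Oriented v pq → ⊥
  reversed-collision {u} {v} u≢v off (w , w<u , same) refl ov = by-copy (w ≟ v)
    where
      fits-u : Fits u (β u , α u)
      fits-u = inj₂ refl , inj₁ refl
      fits-w : Fits w (β u , α u)
      fits-w = fits-same same fits-u
      u≢w : u ≢ w
      u≢w = ≢-sym (<⇒≢ w<u)
      copy-at-v : Oriented w (β u , α u) → ⊥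
      copy-at-v (kept _ _ eq) = off (≡-sym (trans (cong proj₁ eq) (proj₁ same)))
      copy-at-v (reversed _ (w′ , w′<w , same′) _) =
        no-three-fit u≢w (≢-sym (<⇒≢ (ℕ.<-trans w′<w w<u))) (≢-sym (<⇒≢ w′<w))
                     fits-u fits-w (fits-same same′ fits-w)
      copy-at-v (loopFree loop _ _) = off (trans (≡-sym (proj₁ same)) (trans loop (proj₂ same)))
      copy-at-v (loopTaken loop _ _) = off (trans (≡-sym (proj₁ same)) (trans loop (proj₂ same)))
      by-copy : Dec (w ≡ v) → ⊥
      by-copy (no w≢v) = no-three-fit u≢v u≢w (≢-sym w≢v) fits-u (oriented-fits ov) fits-w
      by-copy (yes w≡v) = copy-at-v (subst (λ x → Oriented x _) (≡-sym w≡v) ov)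

  -- A diagonal member u oriented as (other x , x) shares its orientation
  -- with no other member v: the member w carrying (x , other x) fits it too,
  -- and if w = v then v is reversed and has an earlier copy.
  taken-collision : ∀ {u v pq} → u ≢ v → α u ≡ β u → Taken (α u) → pq ≡ (other (α u) , α u) →
                    Oriented v pq → ⊥
  taken-collision {u} {v} u≢v loop (w , αw , βw) refl ov = by-holder (w ≟ v)
    where
      x : Fin (2 + J)
      x = α u
      fits-u : Fits u (other x , x)
      fits-u = inj₂ refl , inj₂ (≡-sym loop)
      fits-w : Fits w (other x , x)
      fits-w = inj₂ αw , inj₁ βw
      not-u : ∀ {w′} → β w′ ≡ β w → u ≢ w′
      not-u same-β u≡w′ =
        other≢ x (trans (≡-sym βw) (trans (≡-sym same-β) (trans (cong β (≡-sym u≡w′)) (≡-sym loop))))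
      holder-at-v : Oriented w (other x , x) → ⊥
      holder-at-v (kept _ _ eq) = other≢ x (trans (cong proj₁ eq) αw)
      holder-at-v (reversed _ (w′ , w′<w , same′) _) =
        no-three-fit (not-u refl) (not-u (proj₂ same′)) (≢-sym (<⇒≢ w′<w))
                     fits-u fits-w (fits-same same′ fits-w)
      holder-at-v (loopFree loop′ _ _) = other≢ x (trans (≡-sym βw) (trans (≡-sym loop′) αw))
      holder-at-v (loopTaken loop′ _ _) = other≢ x (trans (≡-sym βw) (trans (≡-sym loop′) αw))
      by-holder : Dec (w ≡ v) → ⊥
      by-holder (no w≢v) = no-three-fit u≢v (not-u refl) (≢-sym w≢v) fits-u (oriented-fits ov) fits-w
      by-holder (yes w≡v) = holder-at-v (subst (λ y → Oriented y _) (≡-sym w≡v) ov)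

  collision : ∀ {u v pq} → u ≢ v → Oriented u pq → Oriented v pq → ⊥
  collision u≢v (reversed off rep eq) ov = reversed-collision u≢v off rep eq ov
  collision u≢v (loopTaken loop tkn eq) ov = taken-collision u≢v loop tkn eq ov
  collision u≢v ou (reversed off rep eq) = reversed-collision (≢-sym u≢v) off rep eq ou
  collision u≢v ou (loopTaken loop tkn eq) = taken-collision (≢-sym u≢v) loop tkn eq ou
  collision u≢v (kept _ new eq) (kept _ new′ eq′) = kept-collision u≢v new new′ (trans (≡-sym eq) eq′)
  collision {u} u≢v (kept _ _ eq) (loopFree _ free eq′) =
    free (u , cong proj₁ (trans (≡-sym eq) eq′) , cong proj₂ (trans (≡-sym eq) eq′))
  collision {v = v} u≢v (loopFree _ free eq) (kept _ _ eq′) =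
    free (v , cong proj₁ (trans (≡-sym eq′) eq) , cong proj₂ (trans (≡-sym eq′) eq))
  collision u≢v (loopFree loop _ eq) (loopFree loop′ _ eq′) =
    no-two-loops u≢v loop loop′ (cong proj₁ (trans (≡-sym eq) eq′))

  orient-injective : ∀ u v → orient u ≡ orient v → u ≡ v
  orient-injective u v eq with u ≟ v
  ... | yes u≡v = u≡v
  ... | no u≢v = ⊥-elim (collision u≢v (proj₂ (orientation u))
                                       (subst (Oriented v) (≡-sym eq) (proj₂ (orientation v))))

  bound : t ≤ (2 + J) * (1 + J)
  bound = off-diagonal-bound orient (λ v → oriented-off-diagonal (proj₂ (orientation v))) orient-injective

distinct-reps-bound : ∀ {J t} (α β : Fin t → Fin J) → 3 ≤ t → DistinctReps α β → t ≤ J * (J ∸ 1)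
distinct-reps-bound {suc (suc J)} α β 3≤t reps = Orientation.bound α β reps 3≤t
distinct-reps-bound {zero} α β (s≤s (s≤s (s≤s _))) reps
  with reps fz (fs fz) (fs (fs fz)) (λ ()) (λ ()) (λ ())
... | () , _
distinct-reps-bound {suc zero} α β (s≤s (s≤s (s≤s _))) reps
  with reps fz (fs fz) (fs (fs fz)) (λ ()) (λ ()) (λ ())
... | fz , fz , _ , _ , _ , _ , cu≢cv , _ = ⊥-elim (cu≢cv refl)

rainbow-colour-bound : ∀ {t j} (c : EdgeColoring (K2 t) j) → Is3Rainbow c → 3 ≤ t → t ≤ j * (j ∸ 1)
rainbow-colour-bound c rainbow 3≤t =
  distinct-reps-bound (RainbowLeafPairs.α c rainbow) (RainbowLeafPairs.β c rainbow) 3≤t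
                      (RainbowLeafPairs.distinct-reps c rainbow)

-- The upper bound construction.

record LeafLabelling (k t : ℕ) : Set where
  field
    first second : Fin t → Fin k
    distinct     : ∀ i → first i ≢ second i
    injective    : ∀ {i j} → first i ≡ first j → second i ≡ second j → i ≡ j
    avoiding     : (A B C : Fin k) →
                   ∃ λ m → first m ∉ A ∷ B ∷ C ∷ [] × second m ∉ A ∷ B ∷ C ∷ []

module LabelledColouring {k t : ℕ} (L : LeafLabelling (suc k) t) where
  open LeafLabelling L

  -- Pairs of hubs and pairs of leaves are not edges; they get colour 0.
  colour : Fin (2 + t) → Fin (2 + t) → Fin (suc k)
  colour fz (fs (fs i)) = first i
  colour (fs fz) (fs (fs i)) = second i
  colour (fs (fs i)) fz = first i
  colour (fs (fs i)) (fs fz) = second i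
  colour fz fz = fz
  colour fz (fs fz) = fz
  colour (fs fz) fz = fz
  colour (fs fz) (fs fz) = fz
  colour (fs (fs i)) (fs (fs j)) = fz

  colour-sym : ∀ u v → colour u v ≡ colour v u
  colour-sym fz fz = refl
  colour-sym fz (fs fz) = refl
  colour-sym fz (fs (fs i)) = refl
  colour-sym (fs fz) fz = refl
  colour-sym (fs fz) (fs fz) = refl
  colour-sym (fs fz) (fs (fs i)) = refl
  colour-sym (fs (fs i)) fz = refl
  colour-sym (fs (fs i)) (fs fz) = refl
  colour-sym (fs (fs i)) (fs (fs j)) = refl

  C : EdgeColoring (K2 t) (suc k)
  C = record { col = colour ; col-sym = colour-sym }

  R : Fin (2 + t) → Fin (2 + t) → Fin (2 + t) → Set
  R = RainbowSTree3 C

  swap₁₂ : ∀ {x y z} → R x y z → R y x z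
  swap₁₂ (vs , es , T , U , x∈ , y∈ , z∈) = vs , es , T , U , y∈ , x∈ , z∈

  swap₂₃ : ∀ {x y z} → R x y z → R x z y
  swap₂₃ (vs , es , T , U , x∈ , y∈ , z∈) = vs , es , T , U , x∈ , z∈ , y∈

  A~ : ∀ i → Adj (K2 t) hubA (leaf i)
  A~ i = inj₁ (s≤s z≤n , s≤s (s≤s z≤n))
  B~ : ∀ i → Adj (K2 t) hubB (leaf i)
  B~ i = inj₁ (s≤s (s≤s z≤n) , s≤s (s≤s z≤n))
  ~A : ∀ i → Adj (K2 t) (leaf i) hubA
  ~A i = inj₂ (s≤s (s≤s z≤n) , s≤s z≤n)
  ~B : ∀ i → Adj (K2 t) (leaf i) hubB
  ~B i = inj₂ (s≤s (s≤s z≤n) , s≤s (s≤s z≤n))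

  absent : ∀ {x : Fin (2 + t)} {xs} → All (x ≢_) xs → x ∉ xs
  absent = All¬⇒¬Any

  tree-AB : ∀ v → R hubA hubB (leaf v)
  tree-AB v = hubB ∷ leaf v ∷ hubA ∷ [] , (leaf v , hubB) ∷ (hubA , leaf v) ∷ [] ,
    grow (grow (single hubA) (here refl) (absent ((λ ()) ∷ [])) (A~ v))
         (here refl) (absent ((λ ()) ∷ (λ ()) ∷ [])) (~B v) ,
    ((≢-sym (distinct v) ∷ []) ∷ [] ∷ []) ,
    there (there (here refl)) , here refl , there (here refl)

  star-A₂ : ∀ {v w} → v ≢ w → first v ≢ first w → R hubA (leaf v) (leaf w)
  star-A₂ {v} {w} v≢w fv≢fw = leaf w ∷ leaf v ∷ hubA ∷ [] , (hubA , leaf w) ∷ (hubA , leaf v) ∷ [] ,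
    grow (grow (single hubA) (here refl) (absent ((λ ()) ∷ [])) (A~ v))
         (there (here refl)) (absent (leaf≢ (≢-sym v≢w) ∷ (λ ()) ∷ [])) (A~ w) ,
    ((≢-sym fv≢fw ∷ []) ∷ [] ∷ []) ,
    there (there (here refl)) , there (here refl) , here refl

  star-B₂ : ∀ {v w} → v ≢ w → second v ≢ second w → R hubB (leaf v) (leaf w)
  star-B₂ {v} {w} v≢w sv≢sw = leaf w ∷ leaf v ∷ hubB ∷ [] , (hubB , leaf w) ∷ (hubB , leaf v) ∷ [] ,
    grow (grow (single hubB) (here refl) (absent ((λ ()) ∷ [])) (B~ v))
         (there (here refl)) (absent (leaf≢ (≢-sym v≢w) ∷ (λ ()) ∷ [])) (B~ w) ,
    ((≢-sym sv≢sw ∷ []) ∷ [] ∷ []) ,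
    there (there (here refl)) , there (here refl) , here refl

  -- {A, v, w} with first v ≡ first w: the path A – v – B – w; injectivity
  -- of the labelling makes second v ≢ second w.
  path-A₂ : ∀ {v w} → v ≢ w → first v ≡ first w → R hubA (leaf v) (leaf w)
  path-A₂ {v} {w} v≢w fv≡fw =
    leaf w ∷ hubB ∷ leaf v ∷ hubA ∷ [] , (hubB , leaf w) ∷ (leaf v , hubB) ∷ (hubA , leaf v) ∷ [] ,
    grow (grow (grow (single hubA) (here refl) (absent ((λ ()) ∷ [])) (A~ v))
               (here refl) (absent ((λ ()) ∷ (λ ()) ∷ [])) (~B v))
         (here refl) (absent ((λ ()) ∷ leaf≢ (≢-sym v≢w) ∷ (λ ()) ∷ [])) (B~ w) ,
    (((λ eq → v≢w (injective fv≡fw (≡-sym eq))) ∷ (λ eq → distinct w (≡-sym (trans eq fv≡fw))) ∷ []) ∷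
     (≢-sym (distinct v) ∷ []) ∷ [] ∷ []) ,
    there (there (there (here refl))) , there (there (here refl)) , here refl

  path-B₂ : ∀ {v w} → v ≢ w → second v ≡ second w → R hubB (leaf v) (leaf w)
  path-B₂ {v} {w} v≢w sv≡sw =
    leaf w ∷ hubA ∷ leaf v ∷ hubB ∷ [] , (hubA , leaf w) ∷ (leaf v , hubA) ∷ (hubB , leaf v) ∷ [] ,
    grow (grow (grow (single hubB) (here refl) (absent ((λ ()) ∷ [])) (B~ v))
               (here refl) (absent ((λ ()) ∷ (λ ()) ∷ [])) (~A v))
         (here refl) (absent ((λ ()) ∷ leaf≢ (≢-sym v≢w) ∷ (λ ()) ∷ [])) (A~ w) ,
    (((λ eq → v≢w (injective (≡-sym eq) sv≡sw)) ∷ (λ eq → distinct w (trans eq sv≡sw)) ∷ []) ∷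
     (distinct v ∷ []) ∷ [] ∷ []) ,
    there (there (there (here refl))) , there (there (here refl)) , here refl

  tree-A : ∀ {v w} → v ≢ w → R hubA (leaf v) (leaf w)
  tree-A {v} {w} v≢w with first v ≟ first w
  ... | yes fv≡fw = path-A₂ v≢w fv≡fw
  ... | no fv≢fw = star-A₂ v≢w fv≢fw

  tree-B : ∀ {v w} → v ≢ w → R hubB (leaf v) (leaf w)
  tree-B {v} {w} v≢w with second v ≟ second w
  ... | yes sv≡sw = path-B₂ v≢w sv≡sw
  ... | no sv≢sw = star-B₂ v≢w sv≢sw

  star-A₃ : ∀ {u v w} → u ≢ v → u ≢ w → v ≢ w → first u ≢ first v → first u ≢ first w → first v ≢ first w →
            R (leaf u) (leaf v) (leaf w)
  star-A₃ {u} {v} {w} u≢v u≢w v≢w fu≢fv fu≢fw fv≢fw =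
    leaf w ∷ leaf v ∷ leaf u ∷ hubA ∷ [] , (hubA , leaf w) ∷ (hubA , leaf v) ∷ (hubA , leaf u) ∷ [] ,
    grow (grow (grow (single hubA) (here refl) (absent ((λ ()) ∷ [])) (A~ u))
               (there (here refl)) (absent (leaf≢ (≢-sym u≢v) ∷ (λ ()) ∷ [])) (A~ v))
         (there (there (here refl))) (absent (leaf≢ (≢-sym v≢w) ∷ leaf≢ (≢-sym u≢w) ∷ (λ ()) ∷ [])) (A~ w) ,
    ((≢-sym fv≢fw ∷ ≢-sym fu≢fw ∷ []) ∷ (≢-sym fu≢fv ∷ []) ∷ [] ∷ []) ,
    there (there (here refl)) , there (here refl) , here refl

  star-B₃ : ∀ {u v w} → u ≢ v → u ≢ w → v ≢ w → second u ≢ second v → second u ≢ second w → second v ≢ second w →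
            R (leaf u) (leaf v) (leaf w)
  star-B₃ {u} {v} {w} u≢v u≢w v≢w su≢sv su≢sw sv≢sw =
    leaf w ∷ leaf v ∷ leaf u ∷ hubB ∷ [] , (hubB , leaf w) ∷ (hubB , leaf v) ∷ (hubB , leaf u) ∷ [] ,
    grow (grow (grow (single hubB) (here refl) (absent ((λ ()) ∷ [])) (B~ u))
               (there (here refl)) (absent (leaf≢ (≢-sym u≢v) ∷ (λ ()) ∷ [])) (B~ v))
         (there (there (here refl))) (absent (leaf≢ (≢-sym v≢w) ∷ leaf≢ (≢-sym u≢w) ∷ (λ ()) ∷ [])) (B~ w) ,
    ((≢-sym sv≢sw ∷ ≢-sym su≢sw ∷ []) ∷ (≢-sym su≢sv ∷ []) ∷ [] ∷ []) ,
    there (there (here refl)) , there (here refl) , here refl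

  -- Three leaves with first u ≡ first v and second v ≡ second w, and
  -- second u ≢ first w: the tree w – A – v – B – u.
  chain : ∀ {u v w} → u ≢ v → u ≢ w → v ≢ w → first u ≡ first v → second v ≡ second w →
          second u ≢ first w → R (leaf u) (leaf v) (leaf w)
  chain {u} {v} {w} u≢v u≢w v≢w fu≡fv sv≡sw su≢fw =
    leaf w ∷ leaf u ∷ hubB ∷ leaf v ∷ hubA ∷ [] ,
    (hubA , leaf w) ∷ (hubB , leaf u) ∷ (leaf v , hubB) ∷ (hubA , leaf v) ∷ [] ,
    grow (grow (grow (grow (single hubA) (here refl) (absent ((λ ()) ∷ [])) (A~ v))
                     (here refl) (absent ((λ ()) ∷ (λ ()) ∷ [])) (~B v))
               (here refl) (absent ((λ ()) ∷ leaf≢ u≢v ∷ (λ ()) ∷ [])) (B~ u))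
         (there (there (there (here refl))))
         (absent (leaf≢ (≢-sym u≢w) ∷ (λ ()) ∷ leaf≢ (≢-sym v≢w) ∷ (λ ()) ∷ [])) (A~ w) ,
    ((≢-sym su≢fw ∷ (λ eq → distinct w (trans eq sv≡sw)) ∷ (λ eq → v≢w (injective (≡-sym eq) sv≡sw)) ∷ []) ∷
     ((λ eq → u≢v (injective fu≡fv eq)) ∷ (λ eq → distinct u (trans fu≡fv (≡-sym eq))) ∷ []) ∷
     ((λ eq → distinct v (≡-sym eq)) ∷ []) ∷ [] ∷ []) ,
    there (here refl) , there (there (there (here refl))) , here refl

  -- Three leaves with first u ≡ first v, second v ≡ second w and
  -- second u ≡ first w: a leaf m whose labels avoid first v, second v and
  -- first w links the two hubs, giving the tree u, w – A – m – B – v.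
  detour : ∀ {u v w} → u ≢ v → u ≢ w → v ≢ w → first u ≡ first v → second v ≡ second w →
           second u ≡ first w → R (leaf u) (leaf v) (leaf w)
  detour {u} {v} {w} u≢v u≢w v≢w fu≡fv sv≡sw su≡fw with avoiding (first v) (second v) (first w)
  ... | m , fm∉ , sm∉ =
    leaf w ∷ leaf v ∷ leaf u ∷ hubB ∷ leaf m ∷ hubA ∷ [] ,
    (hubA , leaf w) ∷ (hubB , leaf v) ∷ (hubA , leaf u) ∷ (leaf m , hubB) ∷ (hubA , leaf m) ∷ [] ,
    grow (grow (grow (grow (grow (single hubA) (here refl) (absent ((λ ()) ∷ [])) (A~ m))
                           (here refl) (absent ((λ ()) ∷ (λ ()) ∷ [])) (~B m))
                     (there (there (here refl))) (absent ((λ ()) ∷ leaf≢ u≢m ∷ (λ ()) ∷ [])) (A~ u))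
               (there (here refl)) (absent (leaf≢ (≢-sym u≢v) ∷ (λ ()) ∷ leaf≢ v≢m ∷ (λ ()) ∷ [])) (B~ v))
         (there (there (there (there (here refl)))))
         (absent (leaf≢ (≢-sym v≢w) ∷ leaf≢ (≢-sym u≢w) ∷ (λ ()) ∷ leaf≢ w≢m ∷ (λ ()) ∷ [])) (A~ w) ,
    (((λ eq → distinct w (trans eq sv≡sw)) ∷ (λ eq → distinct u (≡-sym (trans su≡fw eq))) ∷
      (λ eq → sm∉ (there (there (here (≡-sym eq))))) ∷ (λ eq → fm∉ (there (there (here (≡-sym eq))))) ∷ []) ∷
     ((λ eq → distinct v (≡-sym (trans eq fu≡fv))) ∷
      (λ eq → sm∉ (there (here (≡-sym eq)))) ∷ (λ eq → fm∉ (there (here (≡-sym eq)))) ∷ []) ∷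
     ((λ eq → sm∉ (here (trans (≡-sym eq) fu≡fv))) ∷ (λ eq → fm∉ (here (trans (≡-sym eq) fu≡fv))) ∷ []) ∷
     (≢-sym (distinct m) ∷ []) ∷ [] ∷ []) ,
    there (there (here refl)) , there (here refl) , here refl
    where
      u≢m : u ≢ m
      u≢m refl = fm∉ (here fu≡fv)
      v≢m : v ≢ m
      v≢m refl = fm∉ (here refl)
      w≢m : w ≢ m
      w≢m refl = fm∉ (there (there (here refl)))

  linked : ∀ {a b c} → a ≢ b → a ≢ c → b ≢ c → first a ≡ first b → second b ≡ second c →
           R (leaf a) (leaf b) (leaf c)
  linked {a} {b} {c} a≢b a≢c b≢c fa≡fb sb≡sc with second a ≟ first c
  ... | yes sa≡fc = detour a≢b a≢c b≢c fa≡fb sb≡sc sa≡fc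
  ... | no sa≢fc = chain a≢b a≢c b≢c fa≡fb sb≡sc sa≢fc

  -- Three leaves: a star at a hub if the labels at that hub are distinct;
  -- otherwise two of the leaves share a first label and two share a second
  -- label, necessarily different pairs by injectivity, and chain or detour applies.
  tree-leaves : ∀ {u v w} → u ≢ v → u ≢ w → v ≢ w → R (leaf u) (leaf v) (leaf w)
  tree-leaves {u} {v} {w} u≢v u≢w v≢w
    with first u ≟ first v | first u ≟ first w | first v ≟ first w
       | second u ≟ second v | second u ≟ second w | second v ≟ second w
  ... | no f₁ | no f₂ | no f₃ | _ | _ | _ = star-A₃ u≢v u≢w v≢w f₁ f₂ f₃
  ... | _ | _ | _ | no s₁ | no s₂ | no s₃ = star-B₃ u≢v u≢w v≢w s₁ s₂ s₃
  ... | yes f | _ | _ | yes s | _ | _ = ⊥-elim (u≢v (injective f s))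
  ... | _ | yes f | _ | _ | yes s | _ = ⊥-elim (u≢w (injective f s))
  ... | _ | _ | yes f | _ | _ | yes s = ⊥-elim (v≢w (injective f s))
  ... | yes f | _ | _ | _ | yes s | _ = swap₁₂ (linked (≢-sym u≢v) v≢w u≢w (≡-sym f) s)
  ... | yes f | _ | _ | _ | _ | yes s = linked u≢v u≢w v≢w f s
  ... | _ | yes f | _ | yes s | _ | _ = swap₂₃ (swap₁₂ (linked (≢-sym u≢w) (≢-sym v≢w) u≢v (≡-sym f) s))
  ... | _ | yes f | _ | _ | _ | yes s = swap₂₃ (linked u≢w u≢v (≢-sym v≢w) f (≡-sym s))
  ... | _ | _ | yes f | yes s | _ | _ = swap₁₂ (swap₂₃ (swap₁₂ (linked (≢-sym v≢w) (≢-sym u≢w) (≢-sym u≢v) (≡-sym f) (≡-sym s))))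
  ... | _ | _ | yes f | _ | yes s | _ = swap₁₂ (swap₂₃ (linked v≢w (≢-sym u≢v) (≢-sym u≢w) f (≡-sym s)))

  unleaf : ∀ {i j : Fin t} → leaf i ≢ leaf j → i ≢ j
  unleaf leaf-i≢leaf-j i≡j = leaf-i≢leaf-j (cong leaf i≡j)

  rainbow : Is3Rainbow C
  rainbow fz fz _ x≢y _ _ = ⊥-elim (x≢y refl)
  rainbow fz (fs fz) fz _ x≢z _ = ⊥-elim (x≢z refl)
  rainbow fz (fs fz) (fs fz) _ _ y≢z = ⊥-elim (y≢z refl)
  rainbow fz (fs fz) (fs (fs i)) _ _ _ = tree-AB i
  rainbow fz (fs (fs i)) fz _ x≢z _ = ⊥-elim (x≢z refl)
  rainbow fz (fs (fs i)) (fs fz) _ _ _ = swap₂₃ (tree-AB i)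
  rainbow fz (fs (fs i)) (fs (fs j)) _ _ y≢z = tree-A (unleaf y≢z)
  rainbow (fs fz) fz fz _ _ y≢z = ⊥-elim (y≢z refl)
  rainbow (fs fz) fz (fs fz) _ x≢z _ = ⊥-elim (x≢z refl)
  rainbow (fs fz) fz (fs (fs i)) _ _ _ = swap₁₂ (tree-AB i)
  rainbow (fs fz) (fs fz) _ x≢y _ _ = ⊥-elim (x≢y refl)
  rainbow (fs fz) (fs (fs i)) fz _ _ _ = swap₂₃ (swap₁₂ (tree-AB i))
  rainbow (fs fz) (fs (fs i)) (fs fz) _ x≢z _ = ⊥-elim (x≢z refl)
  rainbow (fs fz) (fs (fs i)) (fs (fs j)) _ _ y≢z = tree-B (unleaf y≢z)
  rainbow (fs (fs i)) fz fz _ _ y≢z = ⊥-elim (y≢z refl)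
  rainbow (fs (fs i)) fz (fs fz) _ _ _ = swap₁₂ (swap₂₃ (tree-AB i))
  rainbow (fs (fs i)) fz (fs (fs j)) _ x≢z _ = swap₁₂ (tree-A (unleaf x≢z))
  rainbow (fs (fs i)) (fs fz) fz _ _ _ = swap₁₂ (swap₂₃ (swap₁₂ (tree-AB i)))
  rainbow (fs (fs i)) (fs fz) (fs fz) _ _ y≢z = ⊥-elim (y≢z refl)
  rainbow (fs (fs i)) (fs fz) (fs (fs j)) _ x≢z _ = swap₁₂ (tree-B (unleaf x≢z))
  rainbow (fs (fs i)) (fs (fs j)) fz x≢y _ _ = swap₂₃ (swap₁₂ (tree-A (unleaf x≢y)))
  rainbow (fs (fs i)) (fs (fs j)) (fs fz) x≢y _ _ = swap₂₃ (swap₁₂ (tree-B (unleaf x≢y)))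
  rainbow (fs (fs i)) (fs (fs j)) (fs (fs l)) x≢y x≢z y≢z =
    tree-leaves (unleaf x≢y) (unleaf x≢z) (unleaf y≢z)

-- A labelling exists for k + 1 colours, k ≥ 4, and 3k + 4 < t ≤ (k+1)k:
-- leaf i, written as i = k·q + r with q ≤ k and r < k, gets the pair
-- (q , the r-th colour other than q).  The leaves with q ≤ 3 and r ≤ 4
-- are present and realise every pair of colours below 5 that avoid any
-- three given colours.
module GridLabelling (k t : ℕ) (t≤ : t ≤ suc k * k) (4≤k : 4 ≤ k) (room : k * 3 + 4 < t) where

  cell : Fin t → Fin (suc k) × Fin k
  cell i = remQuot {suc k} k (inject≤ i t≤)

  label : Fin (suc k) × Fin k → Fin (suc k) × Fin (suc k)
  label (q , r) = q , punchIn q r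

  first second : Fin t → Fin (suc k)
  first i = proj₁ (label (cell i))
  second i = proj₂ (label (cell i))

  cell-injective : ∀ {i j} → cell i ≡ cell j → i ≡ j
  cell-injective {i} {j} eq = inject≤-injective t≤ t≤ i j
    (trans (≡-sym (combine-remQuot {suc k} k (inject≤ i t≤)))
           (trans (cong (uncurry combine) eq) (combine-remQuot {suc k} k (inject≤ j t≤))))

  label-injective : ∀ {c c′} → proj₁ (label c) ≡ proj₁ (label c′) → proj₂ (label c) ≡ proj₂ (label c′) → c ≡ c′
  label-injective {q , r} {.q , r′} refl eq = cong (q ,_) (punchIn-injective q r r′ eq)

  toℕ-punchOut≤ : ∀ {n} {i j : Fin (suc n)} (i≢j : i ≢ j) → toℕ (punchOut i≢j) ≤ toℕ j
  toℕ-punchOut≤ {_} {fz} {fz} i≢j = ⊥-elim (i≢j refl)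
  toℕ-punchOut≤ {_} {fz} {fs j} _ = ℕ.n≤1+n (toℕ j)
  toℕ-punchOut≤ {suc _} {fs i} {fz} _ = z≤n
  toℕ-punchOut≤ {suc _} {fs i} {fs j} i≢j = s≤s (toℕ-punchOut≤ (λ eq → i≢j (cong fs eq)))

  leaf-at : (q : Fin (suc k)) (r : Fin k) → toℕ q ≤ 3 → toℕ r ≤ 4 → ∃ λ i → cell i ≡ (q , r)
  leaf-at q r q≤3 r≤4 = fromℕ< below , cell-eq
    where
      below : toℕ (combine q r) < t
      below = subst (_< t) (≡-sym (toℕ-combine q r))
                (ℕ.<-≤-trans (s≤s (ℕ.+-mono-≤ (ℕ.*-monoʳ-≤ k q≤3) r≤4)) room)
      cell-eq : cell (fromℕ< below) ≡ (q , r)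
      cell-eq = trans (cong (remQuot {suc k} k)
                            (toℕ-injective (trans (toℕ-inject≤ (fromℕ< below) t≤) (toℕ-fromℕ< below))))
                      (remQuot-combine q r)

  -- Pick q < 4 outside {A, B, C} and s < 5 outside {A, B, C, q}; the leaf
  -- labelled (q , s) sits in a cell with q ≤ 3 and column at most 4.
  avoiding : (A B C : Fin (suc k)) → ∃ λ m → first m ∉ A ∷ B ∷ C ∷ [] × second m ∉ A ∷ B ∷ C ∷ []
  avoiding A B C with fresh (A ∷ B ∷ C ∷ []) (s≤s (s≤s (s≤s (s≤s z≤n)))) (s≤s (ℕ.≤-trans (s≤s (s≤s (s≤s z≤n))) 4≤k))
  ... | q , q<4 , q∉ with fresh (A ∷ B ∷ C ∷ q ∷ []) (s≤s (s≤s (s≤s (s≤s (s≤s z≤n))))) (s≤s 4≤k)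
  ... | s , s<5 , s∉ = m , subst (_∉ A ∷ B ∷ C ∷ []) (≡-sym first-m) q∉ ,
                             subst (_∉ A ∷ B ∷ C ∷ []) (≡-sym second-m) (λ s∈ → s∉ (∈-++⁺ˡ s∈))
    where
      q≢s : q ≢ s
      q≢s eq = s∉ (there (there (there (here (≡-sym eq)))))
      found : ∃ λ i → cell i ≡ (q , punchOut q≢s)
      found = leaf-at q (punchOut q≢s) (ℕ.≤-pred q<4) (ℕ.≤-trans (toℕ-punchOut≤ q≢s) (ℕ.≤-pred s<5))
      m : Fin t
      m = proj₁ found
      first-m : first m ≡ q
      first-m = cong proj₁ (proj₂ found)
      second-m : second m ≡ s
      second-m = trans (cong (λ c → punchIn (proj₁ c) (proj₂ c)) (proj₂ found)) (punchIn-punchOut q≢s)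

  labelling : LeafLabelling (suc k) t
  labelling = record
    { first = first
    ; second = second
    ; distinct = λ i eq → punchInᵢ≢i (proj₁ (cell i)) (proj₂ (cell i)) (≡-sym eq)
    ; injective = λ eq₁ eq₂ → cell-injective (label-injective eq₁ eq₂)
    ; avoiding = avoiding
    }

grid-room : ∀ {k t} → 5 ≤ k → k * (k ∸ 1) < t → k * 3 + 4 < t
grid-room {k} 5≤k k[k-1]<t = ℕ.<-≤-trans (s≤s grid≤) k[k-1]<t
  where
    open ℕ.≤-Reasoning
    grid≤ : k * 3 + 4 ≤ k * (k ∸ 1)
    grid≤ = begin
      k * 3 + 4   ≤⟨ ℕ.+-monoʳ-≤ (k * 3) (ℕ.≤-trans (ℕ.n≤1+n 4) 5≤k) ⟩
      k * 3 + k   ≡⟨ ℕ.+-comm (k * 3) k ⟩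
      k + k * 3   ≡⟨ ℕ.*-suc k 3 ⟨
      k * 4       ≤⟨ ℕ.*-monoʳ-≤ k (ℕ.∸-monoˡ-≤ 1 5≤k) ⟩
      k * (k ∸ 1) ∎

pairs-mono : ∀ {j k} → j < k → j * (j ∸ 1) ≤ (k ∸ 1) * (k ∸ 2)
pairs-mono j<k = ℕ.*-mono-≤ (ℕ.∸-monoˡ-≤ 1 j<k) (ℕ.∸-monoˡ-≤ 2 j<k)

lemma2p6 : (k t : ℕ) → 6 ≤ k → (k ∸ 1) * (k ∸ 2) + 1 ≤ t → t ≤ k * (k ∸ 1) →
    Rx3≡ (K2 t) k
lemma2p6 (suc k) t (s≤s 5≤k) lo hi = upper , lower
  where
    k[k-1]<t : k * (k ∸ 1) < t
    k[k-1]<t = subst (_≤ t) (ℕ.+-comm _ 1) lo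
    room : k * 3 + 4 < t
    room = grid-room 5≤k k[k-1]<t
    upper : Σ (EdgeColoring (K2 t) (suc k)) Is3Rainbow
    upper = LabelledColouring.C labelling , LabelledColouring.rainbow labelling
      where
        labelling : LeafLabelling (suc k) t
        labelling = GridLabelling.labelling k t hi (ℕ.≤-trans (ℕ.n≤1+n 4) 5≤k) room
    -- j < k + 1 colours serve at most j(j-1) ≤ k(k-1) < t leaves.
    lower : ∀ j → j < suc k → ¬ Σ (EdgeColoring (K2 t) j) Is3Rainbow
    lower j j<k (c , rainbow) = ℕ.<⇒≱ k[k-1]<t (ℕ.≤-trans (rainbow-colour-bound c rainbow 3≤t) (pairs-mono j<k))
      where
        3≤t : 3 ≤ t
        3≤t = ℕ.≤-trans (ℕ.n≤1+n 3) (ℕ.≤-trans (ℕ.m≤n+m 4 (k * 3)) (ℕ.<⇒≤ room))
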